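{- For every positive integer $m$, as formal power series in $q$ (with coefficients polynomials in $b$), \[ \sum_{k=1}^{\infty}(-1)^{k-1}\frac{b^k q^{\frac{k(k+1)}{2}+(m-1)k}}{(bq;q)_k(1-q^k)^m} =\sum_{j_1=1}^{\infty}\frac{b^{j_1}q^{j_1}}{1-q^{j_1}}\sum_{j_2=1}^{j_1}\frac{q^{j_2}}{1-q^{j_2}}\cdots\sum_{j_m=1}^{j_{m-1}}\frac{q^{j_m}}{1-q^{j_m}}. \]
   Context: For indeterminates $a,q$ and $k\ge 1$, $(a;q)_k=(1-a)(1-aq)(1-aq^2)\cdots(1-aq^{k-1})$; thus $(bq;q)_k=\prod_{i=1}^k(1-bq^i)$. $b$ is an indeterminate. -}

module Defs where

open import Data.Nat as ℕ using (ℕ; zero; suc; _∸_; _≤_; ⌊_/2⌋)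
open import Data.Integer as ℤ using (ℤ; +_; -_; _+_; _*_)
open import Data.Product using (∃; _×_)
open import Relation.Binary.PropositionalEquality using (_≡_)
open import Relation.Nullary using (yes; no)

-- Formal power series in two variables b, q with integer coefficients:
-- s i n is the coefficient of b^i q^n.  (An element of ℤ[b][[q]] whose
-- q^n-coefficients are polynomials in b is the same as such a series with
-- finitely many nonzero b-coefficients per q-power; all series below are of this kind.)
Series : Set
Series = ℕ → ℕ → ℤ

sumUpTo : ℕ → (ℕ → ℤ) → ℤ
sumUpTo zero    f = f 0
sumUpTo (suc N) f = sumUpTo N f + f (suc N)

zeroS : Series
zeroS _ _ = + 0

mono : ℕ → ℕ → Series
mono i n i' n' with i ℕ.≟ i' | n ℕ.≟ n'
... | yes _ | yes _ = + 1
... | _ | _ = + 0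

oneS : Series
oneS = mono 0 0

_⊕_ : Series → Series → Series
(f ⊕ g) i n = f i n + g i n

negS : Series → Series
negS f i n = - f i n

_⊗_ : Series → Series → Series
(f ⊗ g) i n = sumUpTo i (λ a → sumUpTo n (λ c → f a c * g (i ∸ a) (n ∸ c)))

infixl 6 _⊕_
infixl 7 _⊗_

powS : Series → ℕ → Series
powS f zero    = oneS
powS f (suc r) = f ⊗ powS f r

-- 1/(1 - f) = Σ_{r≥0} f^r, for f with zero constant term (f 0 0 = 0);
-- then f^r has total degree ≥ r, so only r ≤ i + n contribute to the
-- coefficient of b^i q^n.
inv1m : Series → Series
inv1m f i n = sumUpTo (i ℕ.+ n) (λ r → powS f r i n)

sumS : ℕ → (ℕ → Series) → Series
sumS zero    s = zeroS
sumS (suc N) s = sumS N s ⊕ s (suc N)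

-- 1/(bq;q)_k = ∏_{i=1}^{k} 1/(1 - b q^i)
invPoch : ℕ → Series
invPoch zero    = oneS
invPoch (suc k) = invPoch k ⊗ inv1m (mono 1 (suc k))

-- (-1)^(k-1) for k ≥ 1
signS : ℕ → Series → Series
signS zero          f = negS f
signS (suc zero)    f = f
signS (suc (suc k)) f = signS k f

lhsTerm : ℕ → ℕ → Series
lhsTerm m k =
  signS k (mono k (⌊ k ℕ.* suc k /2⌋ ℕ.+ (m ∸ 1) ℕ.* k)
           ⊗ invPoch k ⊗ powS (inv1m (mono 0 k)) m)

geoQ : ℕ → Series
geoQ j = mono 0 j ⊗ inv1m (mono 0 j)

nested : ℕ → ℕ → Series
nested zero    j = oneS
nested (suc r) j = sumS j (λ j' → geoQ j' ⊗ nested r j')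

rhsTerm : ℕ → ℕ → Series
rhsTerm m j = mono j 0 ⊗ geoQ j ⊗ nested (m ∸ 1) j

-- Coefficientwise convergence (formal topology): a sequence of series
-- converges to L if every coefficient is eventually constant equal to L's.
ConvergesTo : (ℕ → Series) → Series → Set
ConvergesTo s L = ∀ i n → ∃ λ N₀ → ∀ N → N₀ ≤ N → s N i n ≡ L i n

module Submission where

-- Write β k i for the coefficient of b^i in b^k/(bq;q)_k (a series in q),
-- βΣ k i = Σ_{l≤i} β k l, and ε k = (-1)^(k-1) q^(k(k-1)/2).  Then the
-- coefficient of b^i in the k-th left-hand term is ε k · β k i · x_k^m.
-- The heart of the proof is the "eigenvalue" relation
--     x_k · β k i = x_i · βΣ k i          (k, i ≥ 1),
-- obtained from a polynomial identity proved by a double induction on k, i.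
-- It turns the b^i-coefficient lhsCoeff N i m of the N-th left partial sum
-- (with exponent m) into
--     lhsCoeff N i (m+1) = x_i · Σ_{l≤i} lhsCoeff N l m,
-- while a telescoping sum shows lhsCoeff N i 0 = [i = 1] once i ≤ N.  Iterating
-- gives exactly the nested sum, which is the b^i-coefficient of the right
-- partial sums for N ≥ i.

open import Defs
open import Data.Nat as ℕ using (ℕ; zero; suc; _∸_; _≤_; _<_; z≤n; s≤s; ⌊_/2⌋)
import Data.Nat.Properties as ℕₚ
open import Data.Nat.Solver using (module +-*-Solver)
open import Data.Integer as ℤ using (ℤ; +_; -_; _+_; _*_)
import Data.Integer.Properties as ℤₚ
open import Data.Product using (∃; _×_; _,_)
open import Data.Maybe using (Maybe; just; nothing)
open import Data.Empty using (⊥-elim)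
open import Function using (_∘_)
open import Level using (0ℓ)
open import Relation.Binary.PropositionalEquality using (_≡_; refl; sym; trans; cong; cong₂)
open import Relation.Binary.Structures using (IsEquivalence)
open import Relation.Nullary using (yes; no; ¬_; Dec)
open import Algebra.Bundles using (CommutativeRing)
open import Algebra.Structures using (IsCommutativeRing)
import Algebra.Solver.Ring.AlmostCommutativeRing as ACR
open import Algebra.Properties.CommutativeSemigroup ℤₚ.+-commutativeSemigroup using (interchange)

sum-cong : ∀ N {f g : ℕ → ℤ} → (∀ a → a ≤ N → f a ≡ g a) → sumUpTo N f ≡ sumUpTo N g
sum-cong zero    h = h 0 z≤n
sum-cong (suc N) h = cong₂ _+_ (sum-cong N (λ a p → h a (ℕₚ.m≤n⇒m≤1+n p))) (h (suc N) ℕₚ.≤-refl)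

sum-+ : ∀ N (f g : ℕ → ℤ) → sumUpTo N (λ a → f a + g a) ≡ sumUpTo N f + sumUpTo N g
sum-+ zero    f g = refl
sum-+ (suc N) f g = trans (cong (_+ (f (suc N) + g (suc N))) (sum-+ N f g))
  (interchange (sumUpTo N f) (sumUpTo N g) (f (suc N)) (g (suc N)))

sum-*ˡ : ∀ N x (f : ℕ → ℤ) → sumUpTo N (λ a → x * f a) ≡ x * sumUpTo N f
sum-*ˡ zero    x f = refl
sum-*ˡ (suc N) x f = trans (cong (_+ x * f (suc N)) (sum-*ˡ N x f))
  (sym (ℤₚ.*-distribˡ-+ x (sumUpTo N f) (f (suc N))))

sum-*ʳ : ∀ N x (f : ℕ → ℤ) → sumUpTo N (λ a → f a * x) ≡ sumUpTo N f * x
sum-*ʳ zero    x f = refl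
sum-*ʳ (suc N) x f = trans (cong (_+ f (suc N) * x) (sum-*ʳ N x f))
  (sym (ℤₚ.*-distribʳ-+ x (sumUpTo N f) (f (suc N))))

sum-zero : ∀ N {f : ℕ → ℤ} → (∀ a → a ≤ N → f a ≡ + 0) → sumUpTo N f ≡ + 0
sum-zero N h = trans (sum-cong N h) (zeros N)
  where
  zeros : ∀ N → sumUpTo N (λ _ → + 0) ≡ + 0
  zeros zero    = refl
  zeros (suc N) = cong (_+ + 0) (zeros N)

sum-single : ∀ N j {f : ℕ → ℤ} → j ≤ N → (∀ a → a ≤ N → ¬ a ≡ j → f a ≡ + 0) →
             sumUpTo N f ≡ f j
sum-single zero    .zero z≤n h = refl
sum-single (suc N) j {f} p h with j ℕ.≟ suc N
... | yes refl = trans (cong (_+ f (suc N)) earlier) (ℤₚ.+-identityˡ (f (suc N)))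
  where
  earlier : sumUpTo N f ≡ + 0
  earlier = sum-zero N (λ a q → h a (ℕₚ.m≤n⇒m≤1+n q) (λ e → ℕₚ.<-irrefl e (s≤s q)))
... | no j≢ = trans (cong₂ _+_ earlier (h (suc N) ℕₚ.≤-refl (j≢ ∘ sym))) (ℤₚ.+-identityʳ (f j))
  where
  earlier : sumUpTo N f ≡ f j
  earlier = sum-single N j (ℕₚ.≤-pred (ℕₚ.≤∧≢⇒< p j≢)) (λ a q → h a (ℕₚ.m≤n⇒m≤1+n q))

sum-truncate : ∀ M N (f : ℕ → ℤ) → M ≤ N → (∀ r → M < r → r ≤ N → f r ≡ + 0) →
               sumUpTo N f ≡ sumUpTo M f
sum-truncate M zero    f z≤n h = refl
sum-truncate M (suc N) f p h with M ℕ.≟ suc N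
... | yes refl = refl
... | no M≢ = trans (cong₂ _+_ shorter (h (suc N) M< ℕₚ.≤-refl)) (ℤₚ.+-identityʳ _)
  where
  M< : M < suc N
  M< = ℕₚ.≤∧≢⇒< p M≢
  shorter : sumUpTo N f ≡ sumUpTo M f
  shorter = sum-truncate M N f (ℕₚ.≤-pred M<) (λ r a b → h r a (ℕₚ.m≤n⇒m≤1+n b))

sum-head : ∀ N (f : ℕ → ℤ) → sumUpTo (suc N) f ≡ f 0 + sumUpTo N (f ∘ suc)
sum-head zero    f = refl
sum-head (suc N) f = trans (cong (_+ f (suc (suc N))) (sum-head N f))
  (ℤₚ.+-assoc (f 0) (sumUpTo N (f ∘ suc)) (f (suc (suc N))))

sum-reverse : ∀ N (f : ℕ → ℤ) → sumUpTo N f ≡ sumUpTo N (λ a → f (N ∸ a))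
sum-reverse zero    f = refl
sum-reverse (suc N) f =
  trans (cong (_+ f (suc N)) (sum-reverse N f))
  (trans (ℤₚ.+-comm _ (f (suc N))) (sym (sum-head N (λ a → f (suc N ∸ a)))))

sum-swap : ∀ N M (F : ℕ → ℕ → ℤ) →
  sumUpTo N (λ a → sumUpTo M (F a)) ≡ sumUpTo M (λ c → sumUpTo N (λ a → F a c))
sum-swap zero    M F = refl
sum-swap (suc N) M F = trans (cong (_+ sumUpTo M (F (suc N))) (sum-swap N M F))
  (sym (sum-+ M (λ c → sumUpTo N (λ a → F a c)) (F (suc N))))

sum-triangle : ∀ n (F : ℕ → ℕ → ℤ) →
  sumUpTo n (λ c → sumUpTo c (λ a → F a c)) ≡
  sumUpTo n (λ a → sumUpTo (n ∸ a) (λ d → F a (a ℕ.+ d)))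
sum-triangle zero    F = refl
sum-triangle (suc n) F =
  trans (cong (_+ sumUpTo (suc n) (λ a → F a (suc n))) (sum-triangle n F))
  (trans (sym (ℤₚ.+-assoc (sumUpTo n G) (sumUpTo n (λ a → F a (suc n))) (F (suc n) (suc n))))
  (trans (cong (_+ F (suc n) (suc n)) (sym (sum-+ n G (λ a → F a (suc n)))))
  (cong₂ _+_ (sum-cong n extend) diagonal)))
  where
  G : ℕ → ℤ
  G a = sumUpTo (n ∸ a) (λ d → F a (a ℕ.+ d))
  diagonal : F (suc n) (suc n) ≡ sumUpTo (suc n ∸ suc n) (λ d → F (suc n) (suc n ℕ.+ d))
  diagonal rewrite ℕₚ.n∸n≡0 n | ℕₚ.+-identityʳ n = refl
  extend : ∀ a → a ≤ n → G a + F a (suc n) ≡ sumUpTo (suc n ∸ a) (λ d → F a (a ℕ.+ d))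
  extend a p rewrite ℕₚ.+-∸-assoc 1 p =
    cong (λ z → G a + z) (cong (F a) (trans (cong suc (sym (ℕₚ.m+[n∸m]≡n p))) (sym (ℕₚ.+-suc a (n ∸ a)))))

-- The ring ℤ[[q]] of one-variable power series (the b^i-coefficients of
-- the two-variable series of Defs), with pointwise equality.

QSeries : Set
QSeries = ℕ → ℤ

infix  4 _≈_
infixl 6 _⊞_
infixl 7 _⊛_

_≈_ : QSeries → QSeries → Set
u ≈ v = ∀ n → u n ≡ v n

_⊞_ : QSeries → QSeries → QSeries
(u ⊞ v) n = u n + v n

⊟ : QSeries → QSeries
⊟ u n = - u n

_⊛_ : QSeries → QSeries → QSeries
(u ⊛ v) n = sumUpTo n (λ c → u c * v (n ∸ c))

0q : QSeries
0q _ = + 0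

1q : QSeries
1q = mono 0 0 0

1⊟_ : QSeries → QSeries
1⊟ x = 1q ⊞ ⊟ x

≈-refl : ∀ {u} → u ≈ u
≈-refl _ = refl

≈-sym : ∀ {u v} → u ≈ v → v ≈ u
≈-sym p n = sym (p n)

≈-trans : ∀ {u v w} → u ≈ v → v ≈ w → u ≈ w
≈-trans p q n = trans (p n) (q n)

⊞-cong : ∀ {u u' v v'} → u ≈ u' → v ≈ v' → u ⊞ v ≈ u' ⊞ v'
⊞-cong p q n = cong₂ _+_ (p n) (q n)

⊛-cong : ∀ {u u' v v'} → u ≈ u' → v ≈ v' → u ⊛ v ≈ u' ⊛ v'
⊛-cong p q n = sum-cong n (λ c _ → cong₂ _*_ (p c) (q (n ∸ c)))

⊛-congʳ : ∀ {u u'} v → u ≈ u' → u ⊛ v ≈ u' ⊛ v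
⊛-congʳ v p = ⊛-cong p (≈-refl {v})

⊛-congˡ : ∀ u {v v'} → v ≈ v' → u ⊛ v ≈ u ⊛ v'
⊛-congˡ u p = ⊛-cong (≈-refl {u}) p

⊛-comm : ∀ u v → u ⊛ v ≈ v ⊛ u
⊛-comm u v n = trans (sum-reverse n _) (sum-cong n λ a p →
  trans (cong (λ z → u (n ∸ a) * v z) (ℕₚ.m∸[m∸n]≡n p)) (ℤₚ.*-comm (u (n ∸ a)) (v a)))

⊛-assoc : ∀ u v w → (u ⊛ v) ⊛ w ≈ u ⊛ (v ⊛ w)
⊛-assoc u v w n =
  trans (sum-cong n (λ c _ → sym (sum-*ʳ c (w (n ∸ c)) (λ a → u a * v (c ∸ a)))))
  (trans (sum-triangle n (λ a c → u a * v (c ∸ a) * w (n ∸ c)))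
  (sum-cong n (λ a _ → trans (sum-cong (n ∸ a) (λ d _ → regroup a d))
                              (sum-*ˡ (n ∸ a) (u a) (λ d → v d * w (n ∸ a ∸ d))))))
  where
  regroup : ∀ a d → u a * v (a ℕ.+ d ∸ a) * w (n ∸ (a ℕ.+ d)) ≡ u a * (v d * w (n ∸ a ∸ d))
  regroup a d = trans (cong₂ (λ x y → u a * v x * w y) (ℕₚ.m+n∸m≡n a d) (sym (ℕₚ.∸-+-assoc n a d)))
                      (ℤₚ.*-assoc (u a) (v d) (w (n ∸ a ∸ d)))

⊛-distribˡ : ∀ u v w → u ⊛ (v ⊞ w) ≈ u ⊛ v ⊞ u ⊛ w
⊛-distribˡ u v w n =
  trans (sum-cong n (λ c _ → ℤₚ.*-distribˡ-+ (u c) (v (n ∸ c)) (w (n ∸ c)))) (sum-+ n _ _)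

⊛-distribʳ : ∀ u v w → (v ⊞ w) ⊛ u ≈ v ⊛ u ⊞ w ⊛ u
⊛-distribʳ u v w n =
  trans (sum-cong n (λ c _ → ℤₚ.*-distribʳ-+ (u (n ∸ c)) (v c) (w c))) (sum-+ n _ _)

⊛-identityˡ : ∀ v → 1q ⊛ v ≈ v
⊛-identityˡ v n = trans (sum-single n 0 z≤n (λ a _ a≢0 → vanish a a≢0)) (ℤₚ.*-identityˡ (v n))
  where
  vanish : ∀ a → ¬ a ≡ 0 → 1q a * v (n ∸ a) ≡ + 0
  vanish zero    a≢0 = ⊥-elim (a≢0 refl)
  vanish (suc a) _   = ℤₚ.*-zeroˡ (v (n ∸ suc a))

⊛-identityʳ : ∀ v → v ⊛ 1q ≈ v
⊛-identityʳ v = ≈-trans (⊛-comm v 1q) (⊛-identityˡ v)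

⊟-cong : ∀ {u v} → u ≈ v → ⊟ u ≈ ⊟ v
⊟-cong p n = cong -_ (p n)

⊛-zeroʳ : ∀ u {v} → v ≈ 0q → u ⊛ v ≈ 0q
⊛-zeroʳ u {v} p n = sum-zero n (λ c _ → trans (cong (u c *_) (p (n ∸ c))) (ℤₚ.*-zeroʳ (u c)))

⊛-zeroˡ : ∀ {u} v → u ≈ 0q → u ⊛ v ≈ 0q
⊛-zeroˡ {u} v p = ≈-trans (⊛-comm u v) (⊛-zeroʳ v p)

qSeriesRing : CommutativeRing 0ℓ 0ℓ
qSeriesRing = record { isCommutativeRing = isCommutativeRing }
  where
  isEquivalence : IsEquivalence _≈_
  isEquivalence = record { refl = ≈-refl ; sym = ≈-sym ; trans = ≈-trans }
  isCommutativeRing : IsCommutativeRing _≈_ _⊞_ _⊛_ ⊟ 0q 1q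
  isCommutativeRing = record
    { isRing = record
      { +-isAbelianGroup = record
        { isGroup = record
          { isMonoid = record
            { isSemigroup = record
              { isMagma = record { isEquivalence = isEquivalence ; ∙-cong = ⊞-cong }
              ; assoc = λ u v w n → ℤₚ.+-assoc (u n) (v n) (w n) }
            ; identity = (λ u n → ℤₚ.+-identityˡ (u n)) , (λ u n → ℤₚ.+-identityʳ (u n)) }
          ; inverse = (λ u n → ℤₚ.+-inverseˡ (u n)) , (λ u n → ℤₚ.+-inverseʳ (u n))
          ; ⁻¹-cong = ⊟-cong }
        ; comm = λ u v n → ℤₚ.+-comm (u n) (v n) }
      ; *-cong = ⊛-cong
      ; *-assoc = ⊛-assoc
      ; *-identity = ⊛-identityˡ , ⊛-identityʳ
      ; distrib = ⊛-distribˡ , ⊛-distribʳ }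
    ; *-comm = ⊛-comm }

open import Relation.Binary.Reasoning.Setoid (CommutativeRing.setoid qSeriesRing)
open import Algebra.Properties.AbelianGroup (CommutativeRing.+-abelianGroup qSeriesRing)
  using (∙-cancelʳ)

-- The constant series c; the clause for 1 makes the constant 1 definitionally 1q.
constant : ℤ → QSeries
constant (+ 1) = 1q
constant c n   = c * 1q n

constant-scales : ∀ c n → constant c n ≡ c * 1q n
constant-scales (+ zero)          n = refl
constant-scales (+ suc zero)      n = sym (ℤₚ.*-identityˡ (1q n))
constant-scales (+ suc (suc k))   n = refl
constant-scales (ℤ.-[1+_] k)      n = refl

constant-⊛ : ∀ c v → constant c ⊛ v ≈ (λ n → c * v n)
constant-⊛ c v n =
  trans (sum-cong n (λ a _ → trans (cong (_* v (n ∸ a)) (constant-scales c a))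
                                    (ℤₚ.*-assoc c (1q a) (v (n ∸ a)))))
  (trans (sum-*ˡ n c (λ a → 1q a * v (n ∸ a))) (cong (c *_) (⊛-identityˡ v n)))

qSeriesACR : ACR.AlmostCommutativeRing 0ℓ 0ℓ
qSeriesACR = ACR.fromCommutativeRing qSeriesRing

constant-homomorphism : ACR._-Raw-AlmostCommutative⟶_ ℤ.+-*-rawRing qSeriesACR
constant-homomorphism = record
  { ⟦_⟧    = constant
  ; +-homo = λ c d n → trans (constant-scales (c + d) n)
      (trans (ℤₚ.*-distribʳ-+ (1q n) c d) (sym (cong₂ _+_ (constant-scales c n) (constant-scales d n))))
  ; *-homo = λ c d n → trans (constant-scales (c * d) n)
      (trans (ℤₚ.*-assoc c d (1q n))
      (trans (cong (c *_) (sym (constant-scales d n))) (sym (constant-⊛ c (constant d) n))))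
  ; -‿homo = λ c n → trans (constant-scales (- c) n)
      (trans (sym (ℤₚ.neg-distribˡ-* c (1q n))) (cong -_ (sym (constant-scales c n))))
  ; 0-homo = λ n → refl
  ; 1-homo = λ n → refl }

constant-≟ : ∀ c d → Maybe (constant c ≈ constant d)
constant-≟ c d with c ℤₚ.≟ d
... | yes refl = just ≈-refl
... | no _     = nothing

open import Algebra.Solver.Ring ℤ.+-*-rawRing qSeriesACR constant-homomorphism constant-≟
  using (solve; _:+_; _:*_; _:-_; :-_; _:=_; con)

mono-hit : ∀ i n → mono i n i n ≡ + 1
mono-hit i n with i ℕ.≟ i | n ℕ.≟ n
... | yes _ | yes _ = refl
... | no i≢ | _     = ⊥-elim (i≢ refl)
... | yes _ | no n≢ = ⊥-elim (n≢ refl)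

mono-missᵇ : ∀ {i n i' n'} → ¬ i ≡ i' → mono i n i' n' ≡ + 0
mono-missᵇ {i} {n} {i'} {n'} i≢ with i ℕ.≟ i' | n ℕ.≟ n'
... | yes e | _     = ⊥-elim (i≢ e)
... | no _  | yes _ = refl
... | no _  | no _  = refl

mono-missᵠ : ∀ {i n i' n'} → ¬ n ≡ n' → mono i n i' n' ≡ + 0
mono-missᵠ {i} {n} {i'} {n'} n≢ with i ℕ.≟ i' | n ℕ.≟ n'
... | _     | yes e = ⊥-elim (n≢ e)
... | yes _ | no _  = refl
... | no _  | no _  = refl

q^_ : ℕ → QSeries
q^ e = mono 0 e 0

q^-cong : ∀ {a b} → a ≡ b → q^ a ≈ q^ b
q^-cong refl = ≈-refl

mono-row : ∀ a c → mono a c a ≈ q^ c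
mono-row a c n = byCases (c ℕ.≟ n)
  where
  byCases : Dec (c ≡ n) → mono a c a n ≡ (q^ c) n
  byCases (yes refl) = trans (mono-hit a c) (sym (mono-hit 0 c))
  byCases (no c≢)    = trans (mono-missᵠ c≢) (sym (mono-missᵠ c≢))

q^-shift : ∀ e f n → e ≤ n → (q^ e ⊛ f) n ≡ f (n ∸ e)
q^-shift e f n p =
  trans (sum-single n e p (λ a _ a≢e → trans (cong (_* f (n ∸ a)) (mono-missᵠ {0} {e} {0} {a} (a≢e ∘ sym)))
                                              (ℤₚ.*-zeroˡ (f (n ∸ a)))))
  (trans (cong (_* f (n ∸ e)) (mono-hit 0 e)) (ℤₚ.*-identityˡ _))

q^-shift-below : ∀ e f n → n < e → (q^ e ⊛ f) n ≡ + 0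
q^-shift-below e f n p = sum-zero n (λ a a≤n →
  trans (cong (_* f (n ∸ a)) (mono-missᵠ {0} {e} {0} {a} (λ e≡a → ℕₚ.<-irrefl (sym e≡a) (ℕₚ.≤-<-trans a≤n p))))
        (ℤₚ.*-zeroˡ (f (n ∸ a))))

q^-+ : ∀ a b → q^ a ⊛ q^ b ≈ q^ (a ℕ.+ b)
q^-+ a b n with a ℕ.≤? n
... | no a≰n = trans (q^-shift-below a (q^ b) n (ℕₚ.≰⇒> a≰n))
                     (sym (mono-missᵠ λ e → a≰n (ℕₚ.≤-trans (ℕₚ.m≤m+n a b) (ℕₚ.≤-reflexive e))))
... | yes a≤n = trans (q^-shift a (q^ b) n a≤n) (compare (b ℕ.≟ n ∸ a))
  where
  compare : Dec (b ≡ n ∸ a) → (q^ b) (n ∸ a) ≡ (q^ (a ℕ.+ b)) n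
  compare (yes refl) = trans (mono-hit 0 b) (trans (sym (mono-hit 0 (a ℕ.+ (n ∸ a))))
                         (cong (mono 0 (a ℕ.+ (n ∸ a)) 0) (ℕₚ.m+[n∸m]≡n a≤n)))
  compare (no b≢) = trans (mono-missᵠ b≢)
                     (sym (mono-missᵠ (λ e → b≢ (trans (sym (ℕₚ.m+n∸m≡n a b)) (cong (_∸ a) e)))))

-- Powers and the geometric series 1/(1 - g) = Σ_r g^r in ℤ[[q]]; for g
-- without constant term only r ≤ n contribute to the coefficient of q^n.

powQ : QSeries → ℕ → QSeries
powQ g zero    = 1q
powQ g (suc r) = g ⊛ powQ g r

geomQ : QSeries → QSeries
geomQ g n = sumUpTo n (λ r → powQ g r n)

q^-pow : ∀ a r → powQ (q^ a) r ≈ q^ (r ℕ.* a)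
q^-pow a zero    = ≈-refl
q^-pow a (suc r) = ≈-trans (⊛-congˡ (q^ a) (q^-pow a r)) (q^-+ a (r ℕ.* a))

powQ-⊛ : ∀ u v r → powQ (u ⊛ v) r ≈ powQ u r ⊛ powQ v r
powQ-⊛ u v zero    = ≈-sym (⊛-identityˡ 1q)
powQ-⊛ u v (suc r) = ≈-trans (⊛-congˡ (u ⊛ v) (powQ-⊛ u v r))
  (solve 4 (λ u v x y → u :* v :* (x :* y) := u :* x :* (v :* y)) ≈-refl u v (powQ u r) (powQ v r))

powQ-low : ∀ g → g 0 ≡ + 0 → ∀ r n → n < r → powQ g r n ≡ + 0
powQ-low g g0 (suc r) n (s≤s n≤r) = sum-zero n vanish
  where
  vanish : ∀ c → c ≤ n → g c * powQ g r (n ∸ c) ≡ + 0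
  vanish zero    _   = trans (cong (_* powQ g r n) g0) (ℤₚ.*-zeroˡ (powQ g r n))
  vanish (suc c) c≤n = trans (cong (g (suc c) *_) (powQ-low g g0 r (n ∸ suc c) lower))
                             (ℤₚ.*-zeroʳ (g (suc c)))
    where
    lower : n ∸ suc c < r
    lower = ℕₚ.<-≤-trans (ℕₚ.∸-monoʳ-< {n} {suc c} {0} (s≤s z≤n) c≤n) n≤r

geomQ-unfold : ∀ g → g 0 ≡ + 0 → geomQ g ≈ 1q ⊞ g ⊛ geomQ g
geomQ-unfold g g0 zero    = sym (cong (λ z → + 1 + z * + 1) g0)
geomQ-unfold g g0 (suc n) =
  trans (sum-head n (λ r → powQ g r (suc n)))
  (cong (λ z → + 0 + z) (sym (trans product (trans (cong (λ z → S + z) top) (ℤₚ.+-identityʳ S)))))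
  where
  m : ℕ
  m = suc n
  S : ℤ
  S = sumUpTo n (λ r → powQ g (suc r) m)
  top : powQ g (suc m) m ≡ + 0
  top = powQ-low g g0 (suc m) m ℕₚ.≤-refl
  product : (g ⊛ geomQ g) m ≡ sumUpTo m (λ r → powQ g (suc r) m)
  product =
    trans (sum-cong m (λ c _ → cong (g c *_) (sym (sum-truncate (m ∸ c) m (λ r → powQ g r (m ∸ c))
            (ℕₚ.m∸n≤m m c) (λ r above _ → powQ-low g g0 r (m ∸ c) above)))))
    (trans (sum-cong m (λ c _ → sym (sum-*ˡ m (g c) (λ r → powQ g r (m ∸ c)))))
    (sum-swap m m (λ c r → g c * powQ g r (m ∸ c))))

geomQ-inverse : ∀ g → g 0 ≡ + 0 → 1⊟ g ⊛ geomQ g ≈ 1q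
geomQ-inverse g g0 = begin
  1⊟ g ⊛ u                 ≈⟨ solve 2 (λ g u → (con (+ 1) :- g) :* u := u :- g :* u) ≈-refl g u ⟩
  u ⊞ ⊟ (g ⊛ u)            ≈⟨ ⊞-cong (geomQ-unfold g g0) (≈-refl {⊟ (g ⊛ u)}) ⟩
  1q ⊞ g ⊛ u ⊞ ⊟ (g ⊛ u)   ≈⟨ solve 1 (λ y → con (+ 1) :+ y :- y := con (+ 1)) ≈-refl (g ⊛ u) ⟩
  1q                       ∎
  where
  u : QSeries
  u = geomQ g

Σ₀ : ℕ → (ℕ → QSeries) → QSeries
Σ₀ N f n = sumUpTo N (λ a → f a n)

Σ₁ : ℕ → (ℕ → QSeries) → QSeries
Σ₁ zero    f = 0q
Σ₁ (suc N) f = Σ₁ N f ⊞ f (suc N)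

Σ₀-cong : ∀ N {f g : ℕ → QSeries} → (∀ a → a ≤ N → f a ≈ g a) → Σ₀ N f ≈ Σ₀ N g
Σ₀-cong N h n = sum-cong N (λ a p → h a p n)

Σ₁-cong : ∀ N {f g : ℕ → QSeries} → (∀ k → 1 ≤ k → k ≤ N → f k ≈ g k) → Σ₁ N f ≈ Σ₁ N g
Σ₁-cong zero    h = ≈-refl
Σ₁-cong (suc N) h = ⊞-cong (Σ₁-cong N (λ k a b → h k a (ℕₚ.m≤n⇒m≤1+n b))) (h (suc N) (s≤s z≤n) ℕₚ.≤-refl)

Σ₀-head : ∀ N (f : ℕ → QSeries) → Σ₀ N f ≈ f 0 ⊞ Σ₁ N f
Σ₀-head zero    f n = sym (ℤₚ.+-identityʳ (f 0 n))
Σ₀-head (suc N) f n = trans (cong (_+ f (suc N) n) (Σ₀-head N f n))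
                            (ℤₚ.+-assoc (f 0 n) (Σ₁ N f n) (f (suc N) n))

⊛-Σ₀ : ∀ u N (f : ℕ → QSeries) → u ⊛ Σ₀ N f ≈ Σ₀ N (λ a → u ⊛ f a)
⊛-Σ₀ u N f n = trans (sum-cong n (λ c _ → sym (sum-*ˡ N (u c) (λ a → f a (n ∸ c)))))
                     (sum-swap n N (λ c a → u c * f a (n ∸ c)))

Σ₀-⊛ : ∀ N (f : ℕ → QSeries) v → Σ₀ N f ⊛ v ≈ Σ₀ N (λ a → f a ⊛ v)
Σ₀-⊛ N f v = ≈-trans (⊛-comm (Σ₀ N f) v) (≈-trans (⊛-Σ₀ v N f) (Σ₀-cong N (λ a _ → ⊛-comm v (f a))))

⊛-Σ₁ : ∀ u N (f : ℕ → QSeries) → u ⊛ Σ₁ N f ≈ Σ₁ N (λ k → u ⊛ f k)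
⊛-Σ₁ u zero    f = ⊛-zeroʳ u ≈-refl
⊛-Σ₁ u (suc N) f = ≈-trans (⊛-distribˡ u (Σ₁ N f) (f (suc N))) (⊞-cong (⊛-Σ₁ u N f) ≈-refl)

Σ₁-Σ₀ : ∀ N M (F : ℕ → ℕ → QSeries) → Σ₁ N (λ k → Σ₀ M (F k)) ≈ Σ₀ M (λ l → Σ₁ N (λ k → F k l))
Σ₁-Σ₀ zero    M F n = sym (sum-zero M (λ _ _ → refl))
Σ₁-Σ₀ (suc N) M F n = trans (cong (_+ Σ₀ M (F (suc N)) n) (Σ₁-Σ₀ N M F n))
  (sym (sum-+ M (λ l → Σ₁ N (λ k → F k l) n) (λ l → F (suc N) l n)))

Σ₁-zero : ∀ N {f : ℕ → QSeries} → (∀ k → 1 ≤ k → k ≤ N → f k ≈ 0q) → Σ₁ N f ≈ 0q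
Σ₁-zero zero    h = ≈-refl
Σ₁-zero (suc N) h n = trans (cong₂ _+_ (Σ₁-zero N (λ k a b → h k a (ℕₚ.m≤n⇒m≤1+n b)) n)
                                       (h (suc N) (s≤s z≤n) ℕₚ.≤-refl n)) refl

Σ₁-single : ∀ N j {f : ℕ → QSeries} → 1 ≤ j → j ≤ N →
            (∀ k → 1 ≤ k → k ≤ N → ¬ k ≡ j → f k ≈ 0q) → Σ₁ N f ≈ f j
Σ₁-single zero    .zero () z≤n h
Σ₁-single (suc N) j {f} p q h n with j ℕ.≟ suc N
... | yes refl = trans (cong (_+ f (suc N) n) (earlier n)) (ℤₚ.+-identityˡ _)
  where
  earlier : Σ₁ N f ≈ 0q
  earlier = Σ₁-zero N (λ k a b → h k a (ℕₚ.m≤n⇒m≤1+n b) (λ e → ℕₚ.<-irrefl e (s≤s b)))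
... | no j≢ = trans (cong₂ _+_ (earlier n) (h (suc N) (s≤s z≤n) ℕₚ.≤-refl (j≢ ∘ sym) n))
                    (ℤₚ.+-identityʳ _)
  where
  earlier : Σ₁ N f ≈ f j
  earlier = Σ₁-single N j p (ℕₚ.≤-pred (ℕₚ.≤∧≢⇒< q j≢)) (λ k a b → h k a (ℕₚ.m≤n⇒m≤1+n b))

[b^_]_ : ℕ → Series → QSeries
[b^ i ] F = F i

[b^]-sumS : ∀ N s i → [b^ i ] (sumS N s) ≈ Σ₁ N (λ k → [b^ i ] (s k))
[b^]-sumS zero    s i n = refl
[b^]-sumS (suc N) s i n = cong (_+ s (suc N) i n) ([b^]-sumS N s i n)

[b^]-mono-⊗ : ∀ a c G i → a ≤ i → [b^ i ] (mono a c ⊗ G) ≈ q^ c ⊛ [b^ (i ∸ a) ] G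
[b^]-mono-⊗ a c G i p n =
  trans (sum-single i a p (λ a' _ a'≢a → ⊛-zeroˡ ([b^ (i ∸ a') ] G)
                                         (λ n' → mono-missᵇ {a} {c} {a'} {n'} (a'≢a ∘ sym)) n))
        (⊛-congʳ ([b^ (i ∸ a) ] G) (mono-row a c) n)

[b^]-mono-⊗-below : ∀ a c G i → i < a → [b^ i ] (mono a c ⊗ G) ≈ 0q
[b^]-mono-⊗-below a c G i p n = sum-zero i (λ a' a'≤i → ⊛-zeroˡ ([b^ (i ∸ a') ] G)
  (λ n' → mono-missᵇ {a} {c} {a'} {n'} (λ e → ℕₚ.<-irrefl (sym e) (ℕₚ.≤-<-trans a'≤i p))) n)

b-free : Series → Set
b-free F = ∀ a n → F (suc a) n ≡ + 0

b-free-gap : ∀ G → b-free G → ∀ {a i} → a ≤ i → ¬ a ≡ i → [b^ (i ∸ a) ] G ≈ 0q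
b-free-gap G G-free {a} {i} a≤i a≢i n with i ∸ a in eq
... | zero  = ⊥-elim (a≢i (ℕₚ.≤-antisym a≤i (ℕₚ.m∸n≡0⇒m≤n eq)))
... | suc d = G-free d n

[b^]-⊗-b-free : ∀ F G → b-free G → ∀ i → [b^ i ] (F ⊗ G) ≈ [b^ i ] F ⊛ [b^ 0 ] G
[b^]-⊗-b-free F G G-free i n =
  trans (sum-single i i ℕₚ.≤-refl (λ a a≤i a≢i → ⊛-zeroʳ ([b^ a ] F) (b-free-gap G G-free a≤i a≢i) n))
        (cong (λ z → ([b^ i ] F ⊛ [b^ z ] G) n) (ℕₚ.n∸n≡0 i))

b-free-⊗ : ∀ F G → b-free F → b-free G → b-free (F ⊗ G)
b-free-⊗ F G F-free G-free a n = sum-zero (suc a) vanish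
  where
  vanish : ∀ a' → a' ≤ suc a → ([b^ a' ] F ⊛ [b^ (suc a ∸ a') ] G) n ≡ + 0
  vanish zero     _ = ⊛-zeroʳ ([b^ 0 ] F) (G-free a) n
  vanish (suc a') _ = ⊛-zeroˡ ([b^ (a ∸ a') ] G) (F-free a') n

b-free-pow : ∀ F → b-free F → ∀ r → b-free (powS F r)
b-free-pow F F-free zero    a n = refl
b-free-pow F F-free (suc r)     = b-free-⊗ F (powS F r) F-free (b-free-pow F F-free r)

b-free-inv : ∀ F → b-free F → b-free (inv1m F)
b-free-inv F F-free a n = sum-zero (suc a ℕ.+ n) (λ r _ → b-free-pow F F-free r a n)

b-free-geoQ : ∀ j → b-free (geoQ j)
b-free-geoQ j = b-free-⊗ (mono 0 j) (inv1m (mono 0 j)) (λ _ _ → refl) (b-free-inv (mono 0 j) (λ _ _ → refl))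

b-free-nested : ∀ r j → b-free (nested r j)
b-free-nested zero    j a n = refl
b-free-nested (suc r) j = sums j
  where
  sums : ∀ N → b-free (sumS N (λ j' → geoQ j' ⊗ nested r j'))
  sums zero    a n = refl
  sums (suc N) a n = cong₂ _+_ (sums N a n)
    (b-free-⊗ (geoQ (suc N)) (nested r (suc N)) (b-free-geoQ (suc N)) (b-free-nested r (suc N)) a n)

[b^0]-powS : ∀ F r → [b^ 0 ] (powS F r) ≈ powQ ([b^ 0 ] F) r
[b^0]-powS F zero    = ≈-refl
[b^0]-powS F (suc r) = ⊛-congˡ ([b^ 0 ] F) ([b^0]-powS F r)

[b^0]-inv1m : ∀ F → [b^ 0 ] (inv1m F) ≈ geomQ ([b^ 0 ] F)
[b^0]-inv1m F n = sum-cong n (λ r _ → [b^0]-powS F r n)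

powS-bq^ : ∀ j t i → [b^ i ] (powS (mono 1 j) t) ≈ [b^ i ] (mono t (j ℕ.* t))
powS-bq^ j zero    i n rewrite ℕₚ.*-zeroʳ j = refl
powS-bq^ j (suc t) zero    n = trans ([b^]-mono-⊗-below 1 j (powS (mono 1 j) t) 0 (s≤s z≤n) n)
                                    (sym (mono-missᵇ {suc t} {j ℕ.* suc t} {0} {n} (λ ())))
powS-bq^ j (suc t) (suc i) n =
  trans ([b^]-mono-⊗ 1 j (powS (mono 1 j) t) (suc i) (s≤s z≤n) n)
  (trans (⊛-congˡ (q^ j) (powS-bq^ j t i) n) (byCases (i ℕ.≟ t)))
  where
  byCases : Dec (i ≡ t) → (q^ j ⊛ [b^ i ] (mono t (j ℕ.* t))) n ≡ mono (suc t) (j ℕ.* suc t) (suc i) n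
  byCases (yes refl) =
    trans (⊛-congˡ (q^ j) (mono-row i (j ℕ.* i)) n)
    (trans (q^-+ j (j ℕ.* i) n)
    (trans (q^-cong (sym (ℕₚ.*-suc j i)) n) (sym (mono-row (suc i) (j ℕ.* suc i) n))))
  byCases (no i≢) =
    trans (⊛-zeroʳ (q^ j) (λ n' → mono-missᵇ {t} {j ℕ.* t} {i} {n'} (i≢ ∘ sym)) n)
          (sym (mono-missᵇ {suc t} {j ℕ.* suc t} {suc i} {n} (λ e → i≢ (sym (ℕₚ.suc-injective e)))))

[b^]-inv1m-bq^ : ∀ j r → [b^ r ] (inv1m (mono 1 j)) ≈ q^ (j ℕ.* r)
[b^]-inv1m-bq^ j r n =
  trans (sum-single (r ℕ.+ n) r (ℕₚ.m≤m+n r n)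
          (λ t _ t≢r → trans (powS-bq^ j t r n) (mono-missᵇ {t} {j ℕ.* t} {r} {n} t≢r)))
  (trans (powS-bq^ j r r n) (mono-row r (j ℕ.* r) n))

poch : ℕ → ℕ → QSeries
poch k l = [b^ l ] (invPoch k)

poch-0 : ∀ k → poch k 0 ≈ 1q
poch-0 zero    = ≈-refl
poch-0 (suc k) = begin
  poch k 0 ⊛ [b^ 0 ] (inv1m (mono 1 (suc k)))
    ≈⟨ ⊛-cong (poch-0 k) (≈-trans ([b^]-inv1m-bq^ (suc k) 0) (q^-cong (ℕₚ.*-zeroʳ k))) ⟩
  1q ⊛ 1q ≈⟨ ⊛-identityˡ 1q ⟩
  1q ∎

poch-suc : ∀ k l → poch (suc k) (suc l) ≈ poch k (suc l) ⊞ q^ (suc k) ⊛ poch (suc k) l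
poch-suc k l = begin
  Σ₀ l (λ a → poch k a ⊛ R (suc l ∸ a)) ⊞ poch k (suc l) ⊛ R (l ∸ l)
    ≈⟨ ⊞-cong (Σ₀-cong l shifted) (≈-trans (⊛-congˡ (poch k (suc l)) R-last) (⊛-identityʳ (poch k (suc l)))) ⟩
  Σ₀ l (λ a → q^ j ⊛ (poch k a ⊛ R (l ∸ a))) ⊞ poch k (suc l)
    ≈⟨ ⊞-cong (≈-sym (⊛-Σ₀ (q^ j) l (λ a → poch k a ⊛ R (l ∸ a)))) ≈-refl ⟩
  q^ j ⊛ poch (suc k) l ⊞ poch k (suc l)
    ≈⟨ (λ n → ℤₚ.+-comm ((q^ j ⊛ poch (suc k) l) n) (poch k (suc l) n)) ⟩
  poch k (suc l) ⊞ q^ j ⊛ poch (suc k) l ∎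
  where
  j : ℕ
  j = suc k
  R : ℕ → QSeries
  R r = [b^ r ] (inv1m (mono 1 j))
  R-last : R (l ∸ l) ≈ 1q
  R-last = ≈-trans (λ n → cong (λ z → R z n) (ℕₚ.n∸n≡0 l))
                   (≈-trans ([b^]-inv1m-bq^ j 0) (q^-cong (ℕₚ.*-zeroʳ j)))
  shifted : ∀ a → a ≤ l → poch k a ⊛ R (suc l ∸ a) ≈ q^ j ⊛ (poch k a ⊛ R (l ∸ a))
  shifted a a≤l = begin
    poch k a ⊛ R (suc l ∸ a)
      ≈⟨ ⊛-congˡ (poch k a) ([b^]-inv1m-bq^ j (suc l ∸ a)) ⟩
    poch k a ⊛ q^ (j ℕ.* (suc l ∸ a))
      ≈⟨ ⊛-congˡ (poch k a) (q^-cong exponent) ⟩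
    poch k a ⊛ q^ (j ℕ.+ j ℕ.* (l ∸ a))
      ≈⟨ ⊛-congˡ (poch k a) (≈-sym (q^-+ j (j ℕ.* (l ∸ a)))) ⟩
    poch k a ⊛ (q^ j ⊛ q^ (j ℕ.* (l ∸ a)))
      ≈⟨ ⊛-congˡ (poch k a) (⊛-congˡ (q^ j) (≈-sym ([b^]-inv1m-bq^ j (l ∸ a)))) ⟩
    poch k a ⊛ (q^ j ⊛ R (l ∸ a))
      ≈⟨ solve 3 (λ p x r → p :* (x :* r) := x :* (p :* r)) ≈-refl (poch k a) (q^ j) (R (l ∸ a)) ⟩
    q^ j ⊛ (poch k a ⊛ R (l ∸ a)) ∎
    where
    exponent : j ℕ.* (suc l ∸ a) ≡ j ℕ.+ j ℕ.* (l ∸ a)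
    exponent = trans (cong (j ℕ.*_) (ℕₚ.+-∸-assoc 1 a≤l)) (ℕₚ.*-suc j (l ∸ a))

-- β k i is the coefficient of b^i in b^k/(bq;q)_k, given by the recursion
-- that poch-suc yields; βΣ k i = Σ_{l≤i} β k l.

β : ℕ → ℕ → QSeries
β zero    zero    = 1q
β zero    (suc i) = 0q
β (suc k) zero    = 0q
β (suc k) (suc i) = β k i ⊞ q^ (suc k) ⊛ β (suc k) i

βΣ : ℕ → ℕ → QSeries
βΣ k i = Σ₀ i (β k)

β-below : ∀ k i → i < k → β k i ≈ 0q
β-below (suc k) zero    _       = ≈-refl
β-below (suc k) (suc i) (s≤s p) n =
  cong₂ _+_ (β-below k i p n) (⊛-zeroʳ (q^ (suc k)) (β-below (suc k) i (ℕₚ.m≤n⇒m≤1+n p)) n)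

β-poch : ∀ k n → β k (k ℕ.+ n) ≈ poch k n
β-poch zero    zero    = ≈-refl
β-poch zero    (suc n) = ≈-refl
β-poch (suc k) zero    = begin
  β k (k ℕ.+ 0) ⊞ q^ (suc k) ⊛ β (suc k) (k ℕ.+ 0)
    ≈⟨ ⊞-cong (≈-trans (β-poch k 0) (poch-0 k))
              (⊛-zeroʳ (q^ (suc k)) (β-below (suc k) (k ℕ.+ 0) (s≤s (ℕₚ.≤-reflexive (ℕₚ.+-identityʳ k))))) ⟩
  1q ⊞ 0q ≈⟨ (λ n → ℤₚ.+-identityʳ (1q n)) ⟩
  1q
    ≈⟨ ≈-sym (poch-0 (suc k)) ⟩
  poch (suc k) 0 ∎
β-poch (suc k) (suc n) = begin
  β k (k ℕ.+ suc n) ⊞ q^ (suc k) ⊛ β (suc k) (k ℕ.+ suc n)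
    ≈⟨ ⊞-cong (β-poch k (suc n))
              (⊛-congˡ (q^ (suc k)) (≈-trans (λ m → cong (λ z → β (suc k) z m) (ℕₚ.+-suc k n)) (β-poch (suc k) n))) ⟩
  poch k (suc n) ⊞ q^ (suc k) ⊛ poch (suc k) n ≈⟨ ≈-sym (poch-suc k n) ⟩
  poch (suc k) (suc n) ∎

[b^]-mono-invPoch : ∀ k e i → [b^ i ] (mono k e ⊗ invPoch k) ≈ q^ e ⊛ β k i
[b^]-mono-invPoch k e i with k ℕ.≤? i
... | yes k≤i = ≈-trans ([b^]-mono-⊗ k e (invPoch k) i k≤i) (⊛-congˡ (q^ e) (≈-sym
                  (≈-trans (λ m → cong (λ z → β k z m) (sym (ℕₚ.m+[n∸m]≡n k≤i))) (β-poch k (i ∸ k)))))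
... | no k≰i = ≈-trans ([b^]-mono-⊗-below k e (invPoch k) i (ℕₚ.≰⇒> k≰i))
                 (≈-sym (⊛-zeroʳ (q^ e) (β-below k i (ℕₚ.≰⇒> k≰i))))

-- For each k, Balanced k implies Shifted k
-- (induction on i), and Balanced k with Shifted k imply Balanced (k+1)
-- (again by induction on i); Balanced 0 is immediate.

Balanced : ℕ → ℕ → Set
Balanced k i = q^ k ⊛ 1⊟ (q^ i) ⊛ β k i ≈ q^ i ⊛ 1⊟ (q^ k) ⊛ βΣ k i

Shifted : ℕ → ℕ → Set
Shifted k i = q^ k ⊛ β (suc k) (suc i) ≈ q^ i ⊛ βΣ k i

by-combination : ∀ {L R X Y} → X ≈ Y → L ⊞ Y ≈ R ⊞ X → L ≈ R
by-combination {L} {R} {X} {Y} X≈Y identity =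
  ∙-cancelʳ Y L R (≈-trans identity (⊞-cong (≈-refl {R}) X≈Y))

shape-cong : ∀ {x x' y y' z z'} → x ≈ x' → y ≈ y' → z ≈ z' → x ⊛ 1⊟ y ⊛ z ≈ x' ⊛ 1⊟ y' ⊛ z'
shape-cong p q r = ⊛-cong (⊛-cong p (⊞-cong (≈-refl {1q}) (⊟-cong q))) r

-- The algebra behind the step k → k+1 of Balanced (Q = q, A = q^k, C = q^i).
balanced-step : ∀ Q A C b sb b' sb' →
  A ⊛ 1⊟ C ⊛ b ≈ C ⊛ 1⊟ A ⊛ sb →
  Q ⊛ A ⊛ 1⊟ C ⊛ b' ≈ C ⊛ 1⊟ (Q ⊛ A) ⊛ sb' →
  Q ⊛ A ⊛ b' ≈ C ⊛ (sb ⊞ ⊟ b) →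
  Q ⊛ A ⊛ 1⊟ (Q ⊛ C) ⊛ (b ⊞ Q ⊛ A ⊛ b') ≈ Q ⊛ C ⊛ 1⊟ (Q ⊛ A) ⊛ (sb' ⊞ (b ⊞ Q ⊛ A ⊛ b'))
balanced-step Q A C b sb b' sb' h₁ h₂ h₃ =
  by-combination (⊞-cong (⊞-cong (⊛-congˡ Q h₁) (⊛-congˡ Q h₂)) (⊛-congˡ (Q ⊛ (A ⊞ ⊟ 1q)) h₃))
    (solve 7 (λ Q A C b sb b' sb' →
       Q :* A :* (con (+ 1) :- Q :* C) :* (b :+ Q :* A :* b')
         :+ (Q :* (C :* (con (+ 1) :- A) :* sb) :+ Q :* (C :* (con (+ 1) :- Q :* A) :* sb')
             :+ Q :* (A :- con (+ 1)) :* (C :* (sb :- b)))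
       := Q :* C :* (con (+ 1) :- Q :* A) :* (sb' :+ (b :+ Q :* A :* b'))
         :+ (Q :* (A :* (con (+ 1) :- C) :* b) :+ Q :* (Q :* A :* (con (+ 1) :- C) :* b')
             :+ Q :* (A :- con (+ 1)) :* (Q :* A :* b')))
       ≈-refl Q A C b sb b' sb')

-- The algebra behind the step i → i+1 of Shifted (Q = q, P = q^k, C = q^i).
shifted-step : ∀ Q P C X Y S →
  P ⊛ Y ≈ C ⊛ S →
  P ⊛ 1⊟ (Q ⊛ C) ⊛ X ≈ Q ⊛ C ⊛ 1⊟ P ⊛ (S ⊞ X) →
  P ⊛ (X ⊞ Q ⊛ P ⊛ Y) ≈ Q ⊛ C ⊛ (S ⊞ X)
shifted-step Q P C X Y S h₁ h₂ =
  by-combination (⊞-cong h₂ (⊛-congˡ (Q ⊛ P) h₁))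
    (solve 6 (λ Q P C X Y S →
       P :* (X :+ Q :* P :* Y) :+ (Q :* C :* (con (+ 1) :- P) :* (S :+ X) :+ Q :* P :* (C :* S))
       := Q :* C :* (S :+ X) :+ (P :* (con (+ 1) :- Q :* C) :* X :+ Q :* P :* (P :* Y)))
       ≈-refl Q P C X Y S)

q^-suc : ∀ k → q^ 1 ⊛ q^ k ≈ q^ (suc k)
q^-suc k = q^-+ 1 k

middle-vanishes : ∀ x z → x ⊛ 1⊟ 1q ⊛ z ≈ 0q
middle-vanishes x z = ⊛-zeroˡ z (⊛-zeroʳ x (λ n → ℤₚ.+-inverseʳ (1q n)))

-- k = 0: one side has the factor β 0 (i+1) = 0 or 1 - q^0 = 0, the other 1 - q^0.
balanced-zero : ∀ i → Balanced 0 i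
balanced-zero zero    = ≈-trans (middle-vanishes 1q (β 0 0)) (≈-sym (middle-vanishes 1q (βΣ 0 0)))
balanced-zero (suc i) = ≈-trans (⊛-zeroʳ (q^ 0 ⊛ 1⊟ (q^ (suc i))) ≈-refl)
                                (≈-sym (middle-vanishes (q^ (suc i)) (βΣ 0 (suc i))))

-- Shifted k (i+1) follows from Shifted k i and Balanced k (i+1).
balanced⇒shifted : ∀ k → (∀ i → Balanced k i) → ∀ i → Shifted k i
balanced⇒shifted zero    bal zero = ⊛-congˡ (q^ 0) (λ n → trans (cong (λ z → 1q n + z) (⊛-zeroʳ (q^ 1) ≈-refl n))
                                                                  (ℤₚ.+-identityʳ (1q n)))
balanced⇒shifted (suc k) bal zero =
  ≈-trans (⊛-zeroʳ (q^ (suc k)) (λ n → trans (ℤₚ.+-identityˡ _) (⊛-zeroʳ (q^ (suc (suc k))) ≈-refl n)))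
          (≈-sym (⊛-zeroʳ (q^ 0) ≈-refl))
balanced⇒shifted k bal (suc i) = begin
  P ⊛ (X ⊞ q^ (suc k) ⊛ Y) ≈⟨ ⊛-congˡ P (⊞-cong (≈-refl {X}) (⊛-congʳ Y (≈-sym (q^-suc k)))) ⟩
  P ⊛ (X ⊞ Q ⊛ P ⊛ Y)
    ≈⟨ shifted-step Q P C X Y S (balanced⇒shifted k bal i) balanced-rewritten ⟩
  Q ⊛ C ⊛ (S ⊞ X)
    ≈⟨ ⊛-congʳ (S ⊞ X) (q^-suc i) ⟩
  q^ (suc i) ⊛ βΣ k (suc i) ∎
  where
  Q P C X Y S : QSeries
  Q = q^ 1
  P = q^ k
  C = q^ i
  X = β k (suc i)
  Y = β (suc k) (suc i)
  S = βΣ k i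
  balanced-rewritten : P ⊛ 1⊟ (Q ⊛ C) ⊛ X ≈ Q ⊛ C ⊛ 1⊟ P ⊛ (S ⊞ X)
  balanced-rewritten = ≈-trans (shape-cong (≈-refl {P}) (q^-suc i) (≈-refl {X}))
                       (≈-trans (bal (suc i)) (shape-cong (≈-sym (q^-suc i)) (≈-refl {P}) (≈-refl {S ⊞ X})))

-- Balanced (k+1) i follows from Balanced k i, Shifted k and Balanced (k+1) (i-1).
balanced-suc : ∀ k → (∀ i → Balanced k i) → (∀ i → Shifted k i) → ∀ i → Balanced (suc k) i
balanced-suc k bal sh zero =
  ≈-trans (⊛-zeroʳ (q^ (suc k) ⊛ 1⊟ (q^ 0)) ≈-refl) (≈-sym (⊛-zeroʳ (q^ 0 ⊛ 1⊟ (q^ (suc k))) ≈-refl))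
balanced-suc k bal sh (suc i) = begin
  q^ (suc k) ⊛ 1⊟ (q^ (suc i)) ⊛ β (suc k) (suc i)
    ≈⟨ shape-cong (≈-sym (q^-suc k)) (≈-sym (q^-suc i)) (⊞-cong (≈-refl {b}) (⊛-congʳ b' (≈-sym (q^-suc k)))) ⟩
  Q ⊛ A ⊛ 1⊟ (Q ⊛ C) ⊛ (b ⊞ Q ⊛ A ⊛ b')
    ≈⟨ balanced-step Q A C b sb b' sb' (bal i) previous (shifted-below i) ⟩
  Q ⊛ C ⊛ 1⊟ (Q ⊛ A) ⊛ (sb' ⊞ (b ⊞ Q ⊛ A ⊛ b'))
    ≈⟨ shape-cong (q^-suc i) (q^-suc k) (⊞-cong (≈-refl {sb'}) (⊞-cong (≈-refl {b}) (⊛-congʳ b' (q^-suc k)))) ⟩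
  q^ (suc i) ⊛ 1⊟ (q^ (suc k)) ⊛ βΣ (suc k) (suc i) ∎
  where
  Q A C b sb b' sb' : QSeries
  Q = q^ 1
  A = q^ k
  C = q^ i
  b = β k i
  sb = βΣ k i
  b' = β (suc k) i
  sb' = βΣ (suc k) i
  previous : Q ⊛ A ⊛ 1⊟ C ⊛ b' ≈ C ⊛ 1⊟ (Q ⊛ A) ⊛ sb'
  previous = ≈-trans (shape-cong (q^-suc k) (≈-refl {C}) (≈-refl {b'}))
             (≈-trans (balanced-suc k bal sh i) (shape-cong (≈-refl {C}) (≈-sym (q^-suc k)) (≈-refl {sb'})))
  -- Shifted k (j-1), rewritten as q^(k+1) β (k+1) j = q^j (βΣ k j - β k j)
  shifted-below : ∀ j → Q ⊛ A ⊛ β (suc k) j ≈ q^ j ⊛ (βΣ k j ⊞ ⊟ (β k j))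
  shifted-below zero    = ≈-trans (⊛-zeroʳ (Q ⊛ A) ≈-refl)
                                  (≈-sym (⊛-zeroʳ (q^ 0) (λ n → ℤₚ.+-inverseʳ (β k 0 n))))
  shifted-below (suc j) = begin
    Q ⊛ A ⊛ β (suc k) (suc j)
      ≈⟨ ⊛-assoc Q A (β (suc k) (suc j)) ⟩
    Q ⊛ (A ⊛ β (suc k) (suc j)) ≈⟨ ⊛-congˡ Q (sh j) ⟩
    Q ⊛ (q^ j ⊛ βΣ k j)
      ≈⟨ ≈-sym (⊛-assoc Q (q^ j) (βΣ k j)) ⟩
    Q ⊛ q^ j ⊛ βΣ k j
      ≈⟨ ⊛-cong (q^-suc j) (solve 2 (λ s x → s := s :+ x :- x) ≈-refl (βΣ k j) (β k (suc j))) ⟩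
    q^ (suc j) ⊛ (βΣ k (suc j) ⊞ ⊟ (β k (suc j))) ∎

balanced : ∀ k i → Balanced k i
balanced zero    = balanced-zero
balanced (suc k) = balanced-suc k (balanced k) (balanced⇒shifted k (balanced k))

inv1-q^ : ℕ → QSeries
inv1-q^ j = [b^ 0 ] (inv1m (mono 0 j))

xq : ℕ → QSeries
xq j = q^ j ⊛ inv1-q^ j

inv1-q^-inverse : ∀ j → 1 ≤ j → 1⊟ (q^ j) ⊛ inv1-q^ j ≈ 1q
inv1-q^-inverse j 1≤j = ≈-trans (⊛-congˡ (1⊟ (q^ j)) ([b^0]-inv1m (mono 0 j)))
  (geomQ-inverse (q^ j) (mono-missᵠ {0} {j} {0} {0} (λ e → ℕₚ.<-irrefl (sym e) 1≤j)))

clear-denominators : ∀ a c ua uc B S → a ⊛ 1⊟ c ⊛ B ≈ c ⊛ 1⊟ a ⊛ S →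
  1⊟ a ⊛ ua ≈ 1q → 1⊟ c ⊛ uc ≈ 1q → a ⊛ ua ⊛ B ≈ c ⊛ uc ⊛ S
clear-denominators a c ua uc B S h ia ic = begin
  a ⊛ ua ⊛ B
    ≈⟨ ≈-sym (⊛-identityʳ (a ⊛ ua ⊛ B)) ⟩
  a ⊛ ua ⊛ B ⊛ 1q
    ≈⟨ ⊛-congˡ (a ⊛ ua ⊛ B) (≈-sym ic) ⟩
  a ⊛ ua ⊛ B ⊛ (1⊟ c ⊛ uc)          ≈⟨ solve 5 (λ a c ua uc B → a :* ua :* B :* ((con (+ 1) :- c) :* uc)
                                                  := ua :* uc :* (a :* (con (+ 1) :- c) :* B)) ≈-refl a c ua uc B ⟩
  ua ⊛ uc ⊛ (a ⊛ 1⊟ c ⊛ B)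
    ≈⟨ ⊛-congˡ (ua ⊛ uc) h ⟩
  ua ⊛ uc ⊛ (c ⊛ 1⊟ a ⊛ S)          ≈⟨ solve 5 (λ a c ua uc S → ua :* uc :* (c :* (con (+ 1) :- a) :* S)
                                                  := c :* uc :* S :* ((con (+ 1) :- a) :* ua)) ≈-refl a c ua uc S ⟩
  c ⊛ uc ⊛ S ⊛ (1⊟ a ⊛ ua)
    ≈⟨ ⊛-congˡ (c ⊛ uc ⊛ S) ia ⟩
  c ⊛ uc ⊛ S ⊛ 1q
    ≈⟨ ⊛-identityʳ (c ⊛ uc ⊛ S) ⟩
  c ⊛ uc ⊛ S ∎

-- x_k β k i = x_i βΣ k i for k, i ≥ 1: clear the denominators of Balanced.
eigenvalue : ∀ k i → 1 ≤ k → 1 ≤ i → xq k ⊛ β k i ≈ xq i ⊛ βΣ k i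
eigenvalue k i 1≤k 1≤i = clear-denominators (q^ k) (q^ i) (inv1-q^ k) (inv1-q^ i) (β k i) (βΣ k i)
  (balanced k i) (inv1-q^-inverse k 1≤k) (inv1-q^-inverse i 1≤i)

sign : ℕ → QSeries → QSeries
sign zero          u = ⊟ u
sign (suc zero)    u = u
sign (suc (suc k)) u = sign k u

[b^]-signS : ∀ k F i → [b^ i ] (signS k F) ≈ sign k ([b^ i ] F)
[b^]-signS zero          F i = ≈-refl
[b^]-signS (suc zero)    F i = ≈-refl
[b^]-signS (suc (suc k)) F i = [b^]-signS k F i

sign-cong : ∀ k {u v} → u ≈ v → sign k u ≈ sign k v
sign-cong zero          p n = cong -_ (p n)
sign-cong (suc zero)    p   = p
sign-cong (suc (suc k)) p   = sign-cong k p

sign-⊛ : ∀ k u v → sign k (u ⊛ v) ≈ sign k u ⊛ v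
sign-⊛ zero          u v = solve 2 (λ u v → :- (u :* v) := (:- u) :* v) ≈-refl u v
sign-⊛ (suc zero)    u v = ≈-refl
sign-⊛ (suc (suc k)) u v = sign-⊛ k u v

sign-suc : ∀ k u → sign (suc k) u ≈ ⊟ (sign k u)
sign-suc zero          u = solve 1 (λ u → u := :- (:- u)) ≈-refl u
sign-suc (suc zero)    u = ≈-refl
sign-suc (suc (suc k)) u = sign-suc k u

tri : ℕ → ℕ
tri k = ⌊ k ℕ.* suc k /2⌋

⌊double+/2⌋ : ∀ y x → ⌊ y ℕ.+ y ℕ.+ x /2⌋ ≡ y ℕ.+ ⌊ x /2⌋
⌊double+/2⌋ zero    x = refl
⌊double+/2⌋ (suc y) x = trans (cong (λ z → ⌊ suc z ℕ.+ x /2⌋) (ℕₚ.+-suc y y)) (cong suc (⌊double+/2⌋ y x))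

tri-suc : ∀ k → tri (suc k) ≡ suc k ℕ.+ tri k
tri-suc k = trans (cong ⌊_/2⌋ (expand k)) (⌊double+/2⌋ (suc k) (k ℕ.* suc k))
  where
  module S = +-*-Solver
  expand : ∀ k → suc k ℕ.* suc (suc k) ≡ suc k ℕ.+ suc k ℕ.+ k ℕ.* suc k
  expand = S.solve 1 (λ k → (S.con 1 S.:+ k) S.:* (S.con 2 S.:+ k)
                        S.:= (S.con 1 S.:+ k) S.:+ (S.con 1 S.:+ k) S.:+ k S.:* (S.con 1 S.:+ k)) refl

-- ε k = (-1)^(k-1) q^(k(k-1)/2), the prefactor of the k-th left-hand term.

ε : ℕ → QSeries
ε zero    = 0q
ε (suc k) = sign (suc k) (q^ tri k)

ε-suc : ∀ k → ε (suc (suc k)) ≈ ⊟ (q^ (suc k) ⊛ ε (suc k))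
ε-suc k = begin
  sign (suc (suc k)) (q^ tri (suc k))
    ≈⟨ sign-cong (suc (suc k)) (q^-cong exponent) ⟩
  sign (suc (suc k)) (q^ (tri k ℕ.+ suc k)) ≈⟨ sign-suc (suc k) _ ⟩
  ⊟ (sign (suc k) (q^ (tri k ℕ.+ suc k)))
    ≈⟨ ⊟-cong (sign-cong (suc k) (≈-sym (q^-+ (tri k) (suc k)))) ⟩
  ⊟ (sign (suc k) (q^ tri k ⊛ q^ (suc k)))
    ≈⟨ ⊟-cong (sign-⊛ (suc k) (q^ tri k) (q^ (suc k))) ⟩
  ⊟ (ε (suc k) ⊛ q^ (suc k))
    ≈⟨ ⊟-cong (⊛-comm (ε (suc k)) (q^ (suc k))) ⟩
  ⊟ (q^ (suc k) ⊛ ε (suc k)) ∎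
  where
  exponent : tri (suc k) ≡ tri k ℕ.+ suc k
  exponent = trans (tri-suc k) (ℕₚ.+-comm (suc k) (tri k))

-- Σ_{k=1}^{N} ε k β k (i+1) telescopes, by the recursion of β and ε-suc.
ε-telescope : ∀ N i → Σ₁ N (λ k → ε k ⊛ β k (suc i)) ≈ β 0 i ⊞ ⊟ (ε (suc N) ⊛ β N i)
ε-telescope zero    i = ≈-sym (≈-trans (⊞-cong (≈-refl {β 0 i}) (⊟-cong (⊛-identityˡ (β 0 i))))
                                      (λ n → ℤₚ.+-inverseʳ (β 0 i n)))
ε-telescope (suc N) i = begin
  Σ₁ N (λ k → ε k ⊛ β k (suc i)) ⊞ e ⊛ (β N i ⊞ x ⊛ b)
    ≈⟨ ⊞-cong (ε-telescope N i) ≈-refl ⟩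
  β 0 i ⊞ ⊟ (e ⊛ β N i) ⊞ e ⊛ (β N i ⊞ x ⊛ b)
    ≈⟨ solve 5 (λ z e c x b → z :- e :* c :+ e :* (c :+ x :* b) := z :- (:- (x :* e)) :* b) ≈-refl (β 0 i) e (β N i) x b ⟩
  β 0 i ⊞ ⊟ (⊟ (x ⊛ e) ⊛ b)
    ≈⟨ ⊞-cong (≈-refl {β 0 i}) (⊟-cong (⊛-congʳ b (≈-sym (ε-suc N)))) ⟩
  β 0 i ⊞ ⊟ (ε (suc (suc N)) ⊛ b) ∎
  where
  e x b : QSeries
  e = ε (suc N)
  x = q^ (suc N)
  b = β (suc N) i

lhsCoeff : ℕ → ℕ → ℕ → QSeries
lhsCoeff N i m = Σ₁ N (λ k → ε k ⊛ β k i ⊛ powQ (xq k) m)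

-- Every left-hand term is divisible by b, so the b^0-coefficient vanishes.
lhsCoeff-b^0 : ∀ N m → lhsCoeff N 0 m ≈ 0q
lhsCoeff-b^0 N m = Σ₁-zero N vanish
  where
  vanish : ∀ k → 1 ≤ k → k ≤ N → ε k ⊛ β k 0 ⊛ powQ (xq k) m ≈ 0q
  vanish (suc k) _ _ = ⊛-zeroˡ (powQ (xq (suc k)) m) (⊛-zeroʳ (ε (suc k)) ≈-refl)

-- Exponent 0: only i = 1 survives (β 0 i = [i = 0]), once the telescope is long enough.
lhsCoeff-exponent-0 : ∀ N i → suc i ≤ N → lhsCoeff N (suc i) 0 ≈ β 0 i
lhsCoeff-exponent-0 N i i<N = begin
  lhsCoeff N (suc i) 0
    ≈⟨ Σ₁-cong N (λ k _ _ → ⊛-identityʳ (ε k ⊛ β k (suc i))) ⟩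
  Σ₁ N (λ k → ε k ⊛ β k (suc i))
    ≈⟨ ε-telescope N i ⟩
  β 0 i ⊞ ⊟ (ε (suc N) ⊛ β N i)
    ≈⟨ ⊞-cong (≈-refl {β 0 i}) (⊟-cong (⊛-zeroʳ (ε (suc N)) (β-below N i i<N))) ⟩
  β 0 i ⊞ ⊟ 0q
    ≈⟨ (λ n → ℤₚ.+-identityʳ (β 0 i n)) ⟩
  β 0 i ∎

-- Raising the exponent: by the eigenvalue relation each term picks up x_i Σ_{l≤i}.
lhsCoeff-exponent-suc : ∀ N i m → 1 ≤ i → lhsCoeff N i (suc m) ≈ xq i ⊛ Σ₀ i (λ l → lhsCoeff N l m)
lhsCoeff-exponent-suc N i m 1≤i = begin
  Σ₁ N (λ k → ε k ⊛ β k i ⊛ (xq k ⊛ X k))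
    ≈⟨ Σ₁-cong N term ⟩
  Σ₁ N (λ k → xq i ⊛ Σ₀ i (λ l → ε k ⊛ β k l ⊛ X k))
    ≈⟨ ≈-sym (⊛-Σ₁ (xq i) N (λ k → Σ₀ i (λ l → ε k ⊛ β k l ⊛ X k))) ⟩
  xq i ⊛ Σ₁ N (λ k → Σ₀ i (λ l → ε k ⊛ β k l ⊛ X k))
    ≈⟨ ⊛-congˡ (xq i) (Σ₁-Σ₀ N i (λ k l → ε k ⊛ β k l ⊛ X k)) ⟩
  xq i ⊛ Σ₀ i (λ l → lhsCoeff N l m) ∎
  where
  X : ℕ → QSeries
  X k = powQ (xq k) m
  term : ∀ k → 1 ≤ k → k ≤ N → ε k ⊛ β k i ⊛ (xq k ⊛ X k) ≈ xq i ⊛ Σ₀ i (λ l → ε k ⊛ β k l ⊛ X k)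
  term k 1≤k _ = begin
    ε k ⊛ β k i ⊛ (xq k ⊛ X k)
      ≈⟨ solve 4 (λ e b x y → e :* b :* (x :* y) := x :* b :* (e :* y)) ≈-refl (ε k) (β k i) (xq k) (X k) ⟩
    xq k ⊛ β k i ⊛ (ε k ⊛ X k)
      ≈⟨ ⊛-congʳ (ε k ⊛ X k) (eigenvalue k i 1≤k 1≤i) ⟩
    xq i ⊛ βΣ k i ⊛ (ε k ⊛ X k)
      ≈⟨ ⊛-assoc (xq i) (βΣ k i) (ε k ⊛ X k) ⟩
    xq i ⊛ (βΣ k i ⊛ (ε k ⊛ X k))
      ≈⟨ ⊛-congˡ (xq i) (Σ₀-⊛ i (β k) (ε k ⊛ X k)) ⟩
    xq i ⊛ Σ₀ i (λ l → β k l ⊛ (ε k ⊛ X k))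
      ≈⟨ ⊛-congˡ (xq i) (Σ₀-cong i (λ l _ → solve 3 (λ b e y → b :* (e :* y) := e :* b :* y) ≈-refl (β k l) (ε k) (X k))) ⟩
    xq i ⊛ Σ₀ i (λ l → ε k ⊛ β k l ⊛ X k) ∎

nestedRow : ℕ → ℕ → QSeries
nestedRow r i = [b^ 0 ] (nested r i)

nestedRow-suc : ∀ r i → nestedRow (suc r) i ≈ Σ₁ i (λ j → xq j ⊛ nestedRow r j)
nestedRow-suc r i = [b^]-sumS i (λ j → geoQ j ⊗ nested r j) 0

-- δ₁ l = [l = 1], written as l ↦ β 0 (l - 1).
δ₁ : ℕ → QSeries
δ₁ zero    = 0q
δ₁ (suc l) = β 0 l

Σ₀-δ₁ : ∀ i → Σ₀ (suc i) δ₁ ≈ 1q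
Σ₀-δ₁ zero    n = ℤₚ.+-identityˡ (1q n)
Σ₀-δ₁ (suc i) n = trans (ℤₚ.+-identityʳ _) (Σ₀-δ₁ i n)

lhsCoeff-nested : ∀ r N i → 1 ≤ i → i ≤ N → lhsCoeff N i (suc r) ≈ xq i ⊛ nestedRow r i
lhsCoeff-nested zero    N (suc i) 1≤i i≤N = begin
  lhsCoeff N (suc i) 1
    ≈⟨ lhsCoeff-exponent-suc N (suc i) 0 1≤i ⟩
  xq (suc i) ⊛ Σ₀ (suc i) (λ l → lhsCoeff N l 0)
    ≈⟨ ⊛-congˡ (xq (suc i)) (Σ₀-cong (suc i) exponent-0) ⟩
  xq (suc i) ⊛ Σ₀ (suc i) δ₁
    ≈⟨ ⊛-congˡ (xq (suc i)) (Σ₀-δ₁ i) ⟩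
  xq (suc i) ⊛ 1q ∎
  where
  exponent-0 : ∀ l → l ≤ suc i → lhsCoeff N l 0 ≈ δ₁ l
  exponent-0 zero    _   = lhsCoeff-b^0 N 0
  exponent-0 (suc l) l≤i = lhsCoeff-exponent-0 N l (ℕₚ.≤-trans l≤i i≤N)
lhsCoeff-nested (suc r) N i 1≤i i≤N = begin
  lhsCoeff N i (suc (suc r))
    ≈⟨ lhsCoeff-exponent-suc N i (suc r) 1≤i ⟩
  xq i ⊛ Σ₀ i (λ l → lhsCoeff N l (suc r))
    ≈⟨ ⊛-congˡ (xq i) (Σ₀-head i (λ l → lhsCoeff N l (suc r))) ⟩
  xq i ⊛ (lhsCoeff N 0 (suc r) ⊞ Σ₁ i (λ l → lhsCoeff N l (suc r)))
    ≈⟨ ⊛-congˡ (xq i) (⊞-cong (lhsCoeff-b^0 N (suc r))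
                               (Σ₁-cong i (λ l 1≤l l≤i → lhsCoeff-nested r N l 1≤l (ℕₚ.≤-trans l≤i i≤N)))) ⟩
  xq i ⊛ (0q ⊞ Σ₁ i (λ l → xq l ⊛ nestedRow r l))
    ≈⟨ ⊛-congˡ (xq i) (≈-trans (λ n → ℤₚ.+-identityˡ _) (≈-sym (nestedRow-suc r i))) ⟩
  xq i ⊛ nestedRow (suc r) i ∎

[b^]-lhsTerm : ∀ m' k' i →
  [b^ i ] (lhsTerm (suc m') (suc k')) ≈ ε (suc k') ⊛ β (suc k') i ⊛ powQ (xq (suc k')) (suc m')
[b^]-lhsTerm m' k' i = begin
  [b^ i ] (lhsTerm m k)
    ≈⟨ [b^]-signS k G i ⟩
  sign k ([b^ i ] G)
    ≈⟨ sign-cong k ([b^]-⊗-b-free (mono k e ⊗ invPoch k) W W-free i) ⟩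
  sign k ([b^ i ] (mono k e ⊗ invPoch k) ⊛ [b^ 0 ] W) ≈⟨ sign-cong k (⊛-cong ([b^]-mono-invPoch k e i) ([b^0]-powS (inv1m (mono 0 k)) m)) ⟩
  sign k (q^ e ⊛ β k i ⊛ U)
    ≈⟨ sign-cong k (⊛-congʳ U (⊛-congʳ (β k i) split-exponent)) ⟩
  sign k (q^ tri k' ⊛ M ⊛ β k i ⊛ U)
    ≈⟨ sign-cong k (solve 4 (λ t x b u → t :* x :* b :* u := t :* (x :* b :* u)) ≈-refl (q^ tri k') M (β k i) U) ⟩
  sign k (q^ tri k' ⊛ (M ⊛ β k i ⊛ U))
    ≈⟨ sign-⊛ k (q^ tri k') (M ⊛ β k i ⊛ U) ⟩
  ε k ⊛ (M ⊛ β k i ⊛ U)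
    ≈⟨ solve 4 (λ e x b u → e :* (x :* b :* u) := e :* b :* (x :* u)) ≈-refl (ε k) M (β k i) U ⟩
  ε k ⊛ β k i ⊛ (M ⊛ U)
    ≈⟨ ⊛-congˡ (ε k ⊛ β k i) (≈-sym (≈-trans (powQ-⊛ (q^ k) (inv1-q^ k) m) (⊛-congʳ U (q^-pow k m)))) ⟩
  ε k ⊛ β k i ⊛ powQ (xq k) m ∎
  where
  m k e : ℕ
  m = suc m'
  k = suc k'
  e = tri k ℕ.+ (m ∸ 1) ℕ.* k
  M U : QSeries
  M = q^ (m ℕ.* k)
  U = powQ (inv1-q^ k) m
  W G : Series
  W = powS (inv1m (mono 0 k)) m
  G = mono k e ⊗ invPoch k ⊗ W
  W-free : b-free W
  W-free = b-free-pow (inv1m (mono 0 k)) (b-free-inv (mono 0 k) (λ _ _ → refl)) m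
  split-exponent : q^ e ≈ q^ tri k' ⊛ M
  split-exponent = ≈-trans (q^-cong exponent) (≈-sym (q^-+ (tri k') (m ℕ.* k)))
    where
    exponent : e ≡ tri k' ℕ.+ m ℕ.* k
    exponent = trans (cong (ℕ._+ m' ℕ.* k) (trans (tri-suc k') (ℕₚ.+-comm k (tri k'))))
                     (ℕₚ.+-assoc (tri k') k (m' ℕ.* k))

[b^]-lhs-partial : ∀ m' N i → [b^ i ] (sumS N (lhsTerm (suc m'))) ≈ lhsCoeff N i (suc m')
[b^]-lhs-partial m' N i = ≈-trans ([b^]-sumS N (lhsTerm (suc m')) i) (Σ₁-cong N termwise)
  where
  termwise : ∀ k → 1 ≤ k → k ≤ N → [b^ i ] (lhsTerm (suc m') k) ≈ ε k ⊛ β k i ⊛ powQ (xq k) (suc m')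
  termwise (suc k') _ _ = [b^]-lhsTerm m' k' i

[b^]-rhsTerm : ∀ m j i → [b^ i ] (rhsTerm m j) ≈ [b^ i ] (mono j 0 ⊗ geoQ j) ⊛ nestedRow (m ∸ 1) j
[b^]-rhsTerm m j i = [b^]-⊗-b-free (mono j 0 ⊗ geoQ j) (nested (m ∸ 1) j) (b-free-nested (m ∸ 1) j) i

[b^]-rhsTerm-diagonal : ∀ m i → [b^ i ] (rhsTerm m i) ≈ xq i ⊛ nestedRow (m ∸ 1) i
[b^]-rhsTerm-diagonal m i = ≈-trans ([b^]-rhsTerm m i i) (⊛-congʳ (nestedRow (m ∸ 1) i)
  (≈-trans ([b^]-mono-⊗ i 0 (geoQ i) i ℕₚ.≤-refl)
  (≈-trans (⊛-identityˡ _) (λ n → cong (λ z → ([b^ z ] (geoQ i)) n) (ℕₚ.n∸n≡0 i)))))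

[b^]-rhsTerm-off : ∀ m j i → ¬ j ≡ i → [b^ i ] (rhsTerm m j) ≈ 0q
[b^]-rhsTerm-off m j i j≢i = ≈-trans ([b^]-rhsTerm m j i) (⊛-zeroˡ (nestedRow (m ∸ 1) j) (byCases (j ℕ.≤? i)))
  where
  byCases : Dec (j ≤ i) → [b^ i ] (mono j 0 ⊗ geoQ j) ≈ 0q
  byCases (no j≰i)  = [b^]-mono-⊗-below j 0 (geoQ j) i (ℕₚ.≰⇒> j≰i)
  byCases (yes j≤i) = ≈-trans ([b^]-mono-⊗ j 0 (geoQ j) i j≤i)
                      (≈-trans (⊛-identityˡ _) (b-free-gap (geoQ j) (b-free-geoQ j) j≤i j≢i))

[b^0]-rhs-partial : ∀ m N → [b^ 0 ] (sumS N (rhsTerm m)) ≈ 0q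
[b^0]-rhs-partial m N = ≈-trans ([b^]-sumS N (rhsTerm m) 0)
  (Σ₁-zero N (λ k 1≤k _ → [b^]-rhsTerm-off m k 0 (λ e → ℕₚ.<-irrefl (sym e) 1≤k)))

[b^]-rhs-partial : ∀ m N i → 1 ≤ i → i ≤ N → [b^ i ] (sumS N (rhsTerm m)) ≈ xq i ⊛ nestedRow (m ∸ 1) i
[b^]-rhs-partial m N i 1≤i i≤N = ≈-trans ([b^]-sumS N (rhsTerm m) i)
  (≈-trans (Σ₁-single N i 1≤i i≤N (λ k _ _ k≢i → [b^]-rhsTerm-off m k i k≢i)) ([b^]-rhsTerm-diagonal m i))

limit : ℕ → Series
limit m zero    = zeroS 0
limit m (suc i) = xq (suc i) ⊛ nestedRow (m ∸ 1) (suc i)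

-- Both partial sums reach the limit coefficientwise: the b^i q^n-coefficient is
-- final from N = i on (from N = 0 for i = 0).
lhs-converges : ∀ m' → ConvergesTo (λ N → sumS N (lhsTerm (suc m'))) (limit (suc m'))
lhs-converges m' zero    n = 0 , λ N _ → trans ([b^]-lhs-partial m' N 0 n) (lhsCoeff-b^0 N (suc m') n)
lhs-converges m' (suc i) n = suc i , λ N i≤N →
  trans ([b^]-lhs-partial m' N (suc i) n) (lhsCoeff-nested m' N (suc i) (s≤s z≤n) i≤N n)

rhs-converges : ∀ m → ConvergesTo (λ N → sumS N (rhsTerm m)) (limit m)
rhs-converges m zero    n = 0 , λ N _ → [b^0]-rhs-partial m N n
rhs-converges m (suc i) n = suc i , λ N i≤N → [b^]-rhs-partial m N (suc i) (s≤s z≤n) i≤N n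

theorem4p4 : (m : ℕ) → 1 ≤ m →
    ∃ λ L → ConvergesTo (λ N → sumS N (lhsTerm m)) L
          × ConvergesTo (λ N → sumS N (rhsTerm m)) L
theorem4p4 (suc m') _ = limit (suc m') , lhs-converges m' , rhs-converges (suc m')
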